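{- Let $T$ be a circle-tree determined by the sequence of circles $(C(i):i<k)$. Then $|\{x\in T:\delta_T(x)=3\}|=2(k-1)$. Consequently, if $T$ is also determined by a sequence of circles $(C'(i):i<k')$, then $k'=k$.
   Context: All graphs are finite simple graphs. A circle is a finite connected graph in which every vertex has degree exactly $2$. For graphs $G=(V,E)$, $H=(V',E')$ with $V\cap V'=\emptyset$, $\Delta(G)\le3$, $\Delta(H)\le3$, and vertices $x\in V$, $y\in V'$ with $\delta_G(x)=\delta_H(y)=2$, let $G+_{x,y}H=(V\cup V',E\cup E'\cup\{(x,y),(y,x)\})$. A finite graph $X$ is a circle-tree if there are $k\ge1$ and graphs $T(0),\dots,T(k-1)$ and circles $C(0),\dots,C(k-1)$ such that $T(0)=C(0)$; for each $0<i<k$, $C(i)$ is disjoint from $T(i-1)$ and $T(i)=T(i-1)+_{x,y}C(i)$ for some $x\in T(i-1)$, $y\in C(i)$ (with $\delta_{T(i-1)}(x)=2$); and $T(k-1)=X$. In that case we say the sequence $(C(i):i<k)$ determines $X$. $\delta_T(x)$ is the degree of $x$ in $T$. -}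

module Defs where

open import Data.Nat using (ℕ; zero; suc; _+_; _*_; _∸_; _≤_; _<_; _≟_)
open import Data.Product using (Σ; ∃; _×_; _,_)
open import Data.Product.Properties using (≡-dec)
open import Data.List using (List; []; _∷_; _++_; length; filter)
open import Data.List.Relation.Unary.Unique.Propositional using (Unique)
open import Relation.Binary.PropositionalEquality using (_≡_)
open import Relation.Nullary using (¬_)
open import Relation.Nullary.Decidable using (⌊_⌋)
open import Relation.Binary using (DecidableEquality)
open import Function.Bundles using (_⇔_)
open import Data.Empty using (⊥)

_≟²_ : DecidableEquality (ℕ × ℕ)
_≟²_ = ≡-dec _≟_ _≟_

open import Data.List.Membership.DecPropositional _≟_ using (_∈_) public
open import Data.List.Membership.DecPropositional _≟²_ using () renaming (_∈_ to _∈ᴱ_; _∈?_ to _∈ᴱ?_) public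

-- A finite graph: a finite list of vertex labels (natural numbers) and
-- a finite list of ordered edges (x , y); an undirected edge {x,y} is
-- represented by both (x , y) and (y , x), as in the paper.
record Graph : Set where
  constructor mkGraph
  field
    V : List ℕ
    E : List (ℕ × ℕ)
open Graph public

record IsGraph (G : Graph) : Set where
  field
    V-unique : Unique (V G)
    E-src    : ∀ {x y} → (x , y) ∈ᴱ E G → x ∈ V G
    E-tgt    : ∀ {x y} → (x , y) ∈ᴱ E G → y ∈ V G
    E-sym    : ∀ {x y} → (x , y) ∈ᴱ E G → (y , x) ∈ᴱ E G
    E-irrefl : ∀ {x} → ¬ ((x , x) ∈ᴱ E G)

deg : Graph → ℕ → ℕ
deg G x = length (filter (λ y → (x , y) ∈ᴱ? E G) (V G))

MaxDeg≤3 : Graph → Set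
MaxDeg≤3 G = ∀ v → v ∈ V G → deg G v ≤ 3

data Reach (G : Graph) : ℕ → ℕ → Set where
  here : ∀ {x} → Reach G x x
  step : ∀ {x y z} → (x , y) ∈ᴱ E G → Reach G y z → Reach G x z

record Circle (C : Graph) : Set where
  field
    isGraph   : IsGraph C
    nonempty  : ∃ λ v → v ∈ V C
    connected : ∀ x y → x ∈ V C → y ∈ V C → Reach C x y
    deg2      : ∀ v → v ∈ V C → deg C v ≡ 2

Disjoint : Graph → Graph → Set
Disjoint G H = ∀ v → v ∈ V G → v ∈ V H → ⊥

glue : Graph → Graph → ℕ → ℕ → Graph
glue G H x y = mkGraph (V G ++ V H) (E G ++ E H ++ ((x , y) ∷ (y , x) ∷ []))

record GlueOK (G H : Graph) (x y : ℕ) : Set where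
  field
    disjoint : Disjoint G H
    ΔG       : MaxDeg≤3 G
    ΔH       : MaxDeg≤3 H
    x∈G      : x ∈ V G
    y∈H      : y ∈ V H
    degx     : deg G x ≡ 2
    degy     : deg H y ≡ 2

_≅_ : Graph → Graph → Set
G ≅ H = (∀ v → (v ∈ V G) ⇔ (v ∈ V H)) × (∀ e → (e ∈ᴱ E G) ⇔ (e ∈ᴱ E H))

record Determines (k : ℕ) (C : ℕ → Graph) (X : Graph) : Set where
  field
    k≥1     : 1 ≤ k
    circles : ∀ i → i < k → Circle (C i)
    T       : ℕ → Graph
    T0      : T 0 ≅ C 0
    Tstep   : ∀ i → suc i < k →
              Σ ℕ λ x → Σ ℕ λ y → GlueOK (T i) (C (suc i)) x y × (T (suc i) ≅ glue (T i) (C (suc i)) x y)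
    Tlast   : T (k ∸ 1) ≅ X

CircleTree : Graph → Set
CircleTree X = Σ ℕ λ k → Σ (ℕ → Graph) λ C → Determines k C X

numDeg3 : Graph → ℕ
numDeg3 G = length (filter (λ x → deg G x ≟ 3) (V G))

{-# OPTIONS --safe #-}
module Submission where

-- Gluing a circle C onto a tree T along a new edge x–y, with deg_T x = deg_C y = 2, raises exactly
-- the degrees of x and y, both from 2 to 3, and changes no other degree. A single circle has no
-- vertex of degree 3, so after k − 1 gluings there are 2(k − 1) of them; as this number depends on
-- X alone, so does k. Degrees and counts are computed as lengths of duplicate-free lists, which
-- agree whenever the lists have the same members (they are then permutations of each other).

open import Defs
open import Data.Nat using (ℕ; zero; suc; _*_; _∸_; _+_; _≤_; _<_; _≟_; z<s)
open import Data.Nat.Properties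
  using ( ≤-trans; ≤-reflexive; ≤-antisym; n≤1+n; <⇒≤; ∸-monoʳ-<; ∸-cancelʳ-≡; *-cancelˡ-≡
        ; *-suc; +-comm)
open import Data.Product using (_×_; _,_; proj₁; proj₂)
open import Data.Sum using (inj₁; inj₂)
open import Data.Empty using (⊥; ⊥-elim)
open import Data.List using (List; _∷_; _++_; length; filter)
open import Data.List.Properties
  using (length-++; length-deduplicate; filter-++; filter-≐; filter-none)
open import Data.List.Relation.Unary.Any using (here; there)
import Data.List.Relation.Unary.All as All
open import Data.List.Relation.Unary.AllPairs using (_∷_)
open import Data.List.Relation.Unary.Unique.Propositional using (Unique)
import Data.List.Relation.Unary.Unique.Propositional.Properties as Unique
open import Data.List.Relation.Unary.Unique.DecPropositional.Properties _≟_ using (deduplicate-!)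
open import Data.List.Membership.Propositional.Properties
  using (∈-++⁻; ∈-++⁺ˡ; ∈-++⁺ʳ; ∈-filter⁺; ∈-filter⁻; deduplicate-∈⇔)
open import Data.List.Membership.Propositional.Properties.WithK using (unique∧set⇒bag)
open import Data.List.Relation.Binary.BagAndSetEquality using (_∼[_]_; set; ∼bag⇒↭; ++-cong)
open import Data.List.Relation.Binary.Permutation.Propositional.Properties using (↭-length)
open import Relation.Binary.PropositionalEquality
  using (_≡_; _≢_; refl; sym; trans; cong; cong₂; module ≡-Reasoning)
open import Relation.Nullary using (yes; no)
open import Relation.Unary using (Decidable; _≐_)
open import Function.Base using (_∘_)
open import Function.Bundles using (_⇔_; mk⇔; Equivalence)
import Function.Properties.Equivalence as ⇔

open Equivalence using (to; from)

unique∧set⇒length≡ : {xs ys : List ℕ} → Unique xs → Unique ys → xs ∼[ set ] ys →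
                     length xs ≡ length ys
unique∧set⇒length≡ ux uy xs≈ys = ↭-length (∼bag⇒↭ (unique∧set⇒bag ux uy xs≈ys))

unique∧set⇒length≤ : {xs ys : List ℕ} → Unique xs → xs ∼[ set ] ys → length xs ≤ length ys
unique∧set⇒length≤ {ys = ys} ux xs≈ys = ≤-trans
  (≤-reflexive (unique∧set⇒length≡ ux (deduplicate-! ys) (⇔.trans xs≈ys (deduplicate-∈⇔ _≟_))))
  (length-deduplicate _≟_ ys)

filter-cong : {P Q : ℕ → Set} (P? : Decidable P) (Q? : Decidable Q) {xs ys : List ℕ} →
              xs ∼[ set ] ys → P ≐ Q → filter P? xs ∼[ set ] filter Q? ys
filter-cong P? Q? xs≈ys (P⊆Q , Q⊆P) = mk⇔
  (λ m → let (x∈xs , p) = ∈-filter⁻ P? m in ∈-filter⁺ Q? (to xs≈ys x∈xs) (P⊆Q p))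
  (λ m → let (x∈ys , q) = ∈-filter⁻ Q? m in ∈-filter⁺ P? (from xs≈ys x∈ys) (Q⊆P q))

≅-sym : {G H : Graph} → G ≅ H → H ≅ G
≅-sym (V≈ , E≈) = (λ v → ⇔.sym (V≈ v)) , (λ e → ⇔.sym (E≈ e))

≅-trans : {G H K : Graph} → G ≅ H → H ≅ K → G ≅ K
≅-trans (V≈ , E≈) (V≈′ , E≈′) = (λ v → ⇔.trans (V≈ v) (V≈′ v)) , (λ e → ⇔.trans (E≈ e) (E≈′ e))

adjacent? : (G : Graph) (v : ℕ) → Decidable (λ z → (v , z) ∈ᴱ E G)
adjacent? G v z = (v , z) ∈ᴱ? E G

neighbours : Graph → ℕ → List ℕ
neighbours G v = filter (adjacent? G v) (V G)

∈-neighbours : {G : Graph} {v z : ℕ} → IsGraph G → z ∈ neighbours G v ⇔ (v , z) ∈ᴱ E G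
∈-neighbours {G} {v} iG = mk⇔ (proj₂ ∘ ∈-filter⁻ (adjacent? G v) {xs = V G})
                                (λ e → ∈-filter⁺ (adjacent? G v) (IsGraph.E-tgt iG e) e)

deg≡length : {G : Graph} {v : ℕ} {ns : List ℕ} → IsGraph G → Unique ns →
             (∀ {z} → z ∈ ns ⇔ (v , z) ∈ᴱ E G) → deg G v ≡ length ns
deg≡length iG uns ns≈ = unique∧set⇒length≡ (Unique.filter⁺ _ (IsGraph.V-unique iG)) uns
  (⇔.trans (∈-neighbours iG) (⇔.sym ns≈))

deg-≤-≅ : {G H : Graph} {v : ℕ} → Unique (V G) → G ≅ H → deg G v ≤ deg H v
deg-≤-≅ uG (V≈ , E≈) = unique∧set⇒length≤ (Unique.filter⁺ _ uG)
  (filter-cong _ _ (λ {z} → V≈ z) (to (E≈ _) , from (E≈ _)))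

deg-≅ : {G H : Graph} {v : ℕ} → Unique (V G) → Unique (V H) → G ≅ H → deg G v ≡ deg H v
deg-≅ uG uH G≅H = ≤-antisym (deg-≤-≅ uG G≅H) (deg-≤-≅ uH (≅-sym G≅H))

numDeg3-≅ : {G H : Graph} → Unique (V G) → Unique (V H) → G ≅ H → numDeg3 G ≡ numDeg3 H
numDeg3-≅ uG uH G≅H@(V≈ , _) = unique∧set⇒length≡ (Unique.filter⁺ _ uG) (Unique.filter⁺ _ uH)
  (filter-cong _ _ (λ {z} → V≈ z) (trans (sym (deg-≅ uG uH G≅H)) , trans (deg-≅ uG uH G≅H)))

deg3In : Graph → List ℕ → List ℕ
deg3In G = filter (λ v → deg G v ≟ 3)

∈-deg3In : ∀ G ws {z} → z ∈ deg3In G ws ⇔ (z ∈ ws × deg G z ≡ 3)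
∈-deg3In G ws = mk⇔ (∈-filter⁻ (λ v → deg G v ≟ 3) {xs = ws})
                    (λ (z∈ws , d) → ∈-filter⁺ (λ v → deg G v ≟ 3) z∈ws d)

numDeg3-circle : ∀ {C} → Circle C → numDeg3 C ≡ 0
numDeg3-circle {C} circ = cong length (filter-none (λ v → deg C v ≟ 3) (All.tabulate deg≢3))
  where
    deg≢3 : ∀ {v} → v ∈ V C → deg C v ≢ 3
    deg≢3 v∈C d with () ← trans (sym (Circle.deg2 circ _ v∈C)) d

data GlueEdge (G H : Graph) (x y a b : ℕ) : Set where
  left    : (a , b) ∈ᴱ E G → GlueEdge G H x y a b
  right   : (a , b) ∈ᴱ E H → GlueEdge G H x y a b
  bridge  : a ≡ x → b ≡ y → GlueEdge G H x y a b
  bridge⁻ : a ≡ y → b ≡ x → GlueEdge G H x y a b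

glue-edge⁻ : ∀ {G H x y a b} → (a , b) ∈ᴱ E (glue G H x y) → GlueEdge G H x y a b
glue-edge⁻ {G} {H} e with ∈-++⁻ (E G) e
... | inj₁ e′ = left e′
... | inj₂ e′ with ∈-++⁻ (E H) e′
...   | inj₁ e″ = right e″
...   | inj₂ (here refl) = bridge refl refl
...   | inj₂ (there (here refl)) = bridge⁻ refl refl

glue-edge⁺ : ∀ {G H x y a b} → GlueEdge G H x y a b → (a , b) ∈ᴱ E (glue G H x y)
glue-edge⁺ (left e) = ∈-++⁺ˡ e
glue-edge⁺ {G} (right e) = ∈-++⁺ʳ (E G) (∈-++⁺ˡ e)
glue-edge⁺ {G} {H} (bridge refl refl) = ∈-++⁺ʳ (E G) (∈-++⁺ʳ (E H) (here refl))
glue-edge⁺ {G} {H} (bridge⁻ refl refl) = ∈-++⁺ʳ (E G) (∈-++⁺ʳ (E H) (there (here refl)))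

glue-edge-swap : ∀ {G H x y a b} → (a , b) ∈ᴱ E (glue G H x y) → (a , b) ∈ᴱ E (glue H G y x)
glue-edge-swap {G} {H} e = glue-edge⁺ {H} {G} (swap (glue-edge⁻ {G} {H} e))
  where
    swap : ∀ {x y a b} → GlueEdge G H x y a b → GlueEdge H G y x a b
    swap (left e′) = right e′
    swap (right e′) = left e′
    swap (bridge p q) = bridge⁻ p q
    swap (bridge⁻ p q) = bridge p q

glue-congˡ : ∀ {G G′ H x y} → G ≅ G′ → glue G H x y ≅ glue G′ H x y
glue-congˡ (V≈ , E≈) = (λ _ → ++-cong (λ {u} → V≈ u) ⇔.refl) , (λ _ → ++-cong (λ {f} → E≈ f) ⇔.refl)

record Gluable (G H : Graph) (x y : ℕ) : Set where
  field
    isGraphˡ : IsGraph G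
    isGraphʳ : IsGraph H
    disjoint : Disjoint G H
    x∈G      : x ∈ V G
    y∈H      : y ∈ V H

Gluable-swap : ∀ {G H x y} → Gluable G H x y → Gluable H G y x
Gluable-swap g = record
  { isGraphˡ = isGraphʳ
  ; isGraphʳ = isGraphˡ
  ; disjoint = λ v v∈H v∈G → disjoint v v∈G v∈H
  ; x∈G = y∈H
  ; y∈H = x∈G
  }
  where open Gluable g

module _ {G H : Graph} {x y : ℕ} (g : Gluable G H x y) where
  open Gluable g

  uG : Unique (V G)
  uG = IsGraph.V-unique isGraphˡ

  glue-isGraph : IsGraph (glue G H x y)
  glue-isGraph = record
    { V-unique = Unique.++⁺ uG (IsGraph.V-unique isGraphʳ)
                   (λ (v∈G , v∈H) → disjoint _ v∈G v∈H)
    ; E-src = λ e → src (glue-edge⁻ e)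
    ; E-tgt = λ e → src (sym-edge (glue-edge⁻ e))
    ; E-sym = λ e → glue-edge⁺ (sym-edge (glue-edge⁻ e))
    ; E-irrefl = λ e → irrefl (glue-edge⁻ e)
    }
    where
      src : ∀ {a b} → GlueEdge G H x y a b → a ∈ V (glue G H x y)
      src (left e) = ∈-++⁺ˡ (IsGraph.E-src isGraphˡ e)
      src (right e) = ∈-++⁺ʳ (V G) (IsGraph.E-src isGraphʳ e)
      src (bridge refl _) = ∈-++⁺ˡ x∈G
      src (bridge⁻ refl _) = ∈-++⁺ʳ (V G) y∈H
      sym-edge : ∀ {a b} → GlueEdge G H x y a b → GlueEdge G H x y b a
      sym-edge (left e) = left (IsGraph.E-sym isGraphˡ e)
      sym-edge (right e) = right (IsGraph.E-sym isGraphʳ e)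
      sym-edge (bridge p q) = bridge⁻ q p
      sym-edge (bridge⁻ p q) = bridge q p
      irrefl : ∀ {a} → GlueEdge G H x y a a → ⊥
      irrefl (left e) = IsGraph.E-irrefl isGraphˡ e
      irrefl (right e) = IsGraph.E-irrefl isGraphʳ e
      irrefl (bridge refl refl) = disjoint _ x∈G y∈H
      irrefl (bridge⁻ refl refl) = disjoint _ x∈G y∈H

  deg-glue-inner : ∀ {v} → v ∈ V G → v ≢ x → deg (glue G H x y) v ≡ deg G v
  deg-glue-inner {v} v∈G v≢x = deg≡length glue-isGraph (Unique.filter⁺ _ uG)
    (mk⇔ (glue-edge⁺ ∘ outer) (inner ∘ glue-edge⁻))
    where
      outer : ∀ {z} → z ∈ neighbours G v → GlueEdge G H x y v z
      outer = left ∘ to (∈-neighbours isGraphˡ)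
      inner : ∀ {z} → GlueEdge G H x y v z → z ∈ neighbours G v
      inner (left e) = from (∈-neighbours isGraphˡ) e
      inner (right e) = ⊥-elim (disjoint v v∈G (IsGraph.E-src isGraphʳ e))
      inner (bridge v≡x _) = ⊥-elim (v≢x v≡x)
      inner (bridge⁻ refl _) = ⊥-elim (disjoint v v∈G y∈H)

  deg-glue-x : deg (glue G H x y) x ≡ suc (deg G x)
  deg-glue-x = deg≡length glue-isGraph (y∉ ∷ Unique.filter⁺ _ uG)
    (mk⇔ (glue-edge⁺ ∘ outer) (inner ∘ glue-edge⁻))
    where
      y∉ : All.All (y ≢_) (neighbours G x)
      y∉ = All.tabulate λ { m refl → disjoint y (proj₁ (∈-filter⁻ (adjacent? G x) m)) y∈H }
      outer : ∀ {z} → z ∈ y ∷ neighbours G x → GlueEdge G H x y x z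
      outer (here refl) = bridge refl refl
      outer (there m) = left (to (∈-neighbours isGraphˡ) m)
      inner : ∀ {z} → GlueEdge G H x y x z → z ∈ y ∷ neighbours G x
      inner (left e) = there (from (∈-neighbours isGraphˡ) e)
      inner (right e) = ⊥-elim (disjoint x x∈G (IsGraph.E-src isGraphʳ e))
      inner (bridge _ refl) = here refl
      inner (bridge⁻ refl _) = ⊥-elim (disjoint x x∈G y∈H)

  deg-glue-≥ : ∀ {v} → v ∈ V G → deg G v ≤ deg (glue G H x y) v
  deg-glue-≥ {v} v∈G with v ≟ x
  ... | yes refl = ≤-trans (n≤1+n _) (≤-reflexive (sym deg-glue-x))
  ... | no v≢x = ≤-reflexive (sym (deg-glue-inner v∈G v≢x))

  numDeg3-glue-inner : deg G x ≡ 2 → length (deg3In (glue G H x y) (V G)) ≡ suc (numDeg3 G)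
  numDeg3-glue-inner degx = unique∧set⇒length≡ (Unique.filter⁺ _ uG)
    (All.tabulate (λ m → ≢x m ∘ sym) ∷ Unique.filter⁺ _ uG) (mk⇔ to′ from′)
    where
      ≢x : ∀ {z} → z ∈ deg3In G (V G) → z ≢ x
      ≢x m refl with () ← trans (sym degx) (proj₂ (to (∈-deg3In G (V G)) m))
      to′ : ∀ {z} → z ∈ deg3In (glue G H x y) (V G) → z ∈ x ∷ deg3In G (V G)
      to′ {z} m with to (∈-deg3In (glue G H x y) (V G)) m | z ≟ x
      ... | _ , _ | yes z≡x = here z≡x
      ... | z∈G , d | no z≢x =
        there (from (∈-deg3In G (V G)) (z∈G , trans (sym (deg-glue-inner z∈G z≢x)) d))
      from′ : ∀ {z} → z ∈ x ∷ deg3In G (V G) → z ∈ deg3In (glue G H x y) (V G)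
      from′ (here refl) =
        from (∈-deg3In (glue G H x y) (V G)) (x∈G , trans deg-glue-x (cong suc degx))
      from′ (there m) with to (∈-deg3In G (V G)) m
      ... | z∈G , d = from (∈-deg3In (glue G H x y) (V G)) (z∈G , trans (deg-glue-inner z∈G (≢x m)) d)

module _ {G H : Graph} {x y : ℕ} (g : Gluable G H x y) where

  deg-glue-swap : ∀ {v} → deg (glue G H x y) v ≡ deg (glue H G y x) v
  deg-glue-swap = sym (deg≡length (glue-isGraph (Gluable-swap g))
    (Unique.filter⁺ _ (IsGraph.V-unique (glue-isGraph g)))
    (⇔.trans (∈-neighbours (glue-isGraph g))
             (mk⇔ (glue-edge-swap {G} {H}) (glue-edge-swap {H} {G}))))

  deg-glue-≥ʳ : ∀ {v} → v ∈ V H → deg H v ≤ deg (glue G H x y) v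
  deg-glue-≥ʳ v∈H = ≤-trans (deg-glue-≥ (Gluable-swap g) v∈H) (≤-reflexive (sym deg-glue-swap))

  numDeg3-glue : deg G x ≡ 2 → deg H y ≡ 2 →
                 numDeg3 (glue G H x y) ≡ suc (numDeg3 G) + suc (numDeg3 H)
  numDeg3-glue degx degy = begin
    numDeg3 (glue G H x y)
      ≡⟨ cong length (filter-++ _ (V G) (V H)) ⟩
    length (deg3In (glue G H x y) (V G) ++ deg3In (glue G H x y) (V H))
      ≡⟨ length-++ (deg3In (glue G H x y) (V G)) ⟩
    length (deg3In (glue G H x y) (V G)) + length (deg3In (glue G H x y) (V H))
      ≡⟨ cong (length (deg3In (glue G H x y) (V G)) +_)
              (cong length (filter-≐ _ _ (trans (sym deg-glue-swap) , trans deg-glue-swap) (V H))) ⟩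
    length (deg3In (glue G H x y) (V G)) + length (deg3In (glue H G y x) (V H))
      ≡⟨ cong₂ _+_ (numDeg3-glue-inner g degx) (numDeg3-glue-inner (Gluable-swap g) degy) ⟩
    suc (numDeg3 G) + suc (numDeg3 H) ∎
    where open ≡-Reasoning

-- The stages T i of a circle-tree are fixed only up to ≅ and their vertex lists may repeat vertices,
-- so deg (T i) can overcount. S is a duplicate-free representative; its minimum degree 2 turns the
-- bound deg S x ≤ deg (T i) x = 2 at the gluing vertex into an equality.
record Normalised (T : Graph) (i : ℕ) : Set where
  field
    S         : Graph
    S-isGraph : IsGraph S
    T≅S       : T ≅ S
    deg≥2     : ∀ {v} → v ∈ V S → 2 ≤ deg S v
    numDeg3-S : numDeg3 S ≡ 2 * i

normalised-circle : ∀ {T C} → Circle C → T ≅ C → Normalised T 0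
normalised-circle {C = C} circ T≅C = record
  { S = C
  ; S-isGraph = Circle.isGraph circ
  ; T≅S = T≅C
  ; deg≥2 = λ v∈C → ≤-reflexive (sym (Circle.deg2 circ _ v∈C))
  ; numDeg3-S = numDeg3-circle circ
  }

normalised-glue : ∀ {T T′ C x y i} → Normalised T i → Circle C → GlueOK T C x y →
                  T′ ≅ glue T C x y → Normalised T′ (suc i)
normalised-glue {C = C} {x} {y} {i} N circ ok T′≅ = record
  { S = glue S C x y
  ; S-isGraph = glue-isGraph g
  ; T≅S = ≅-trans T′≅ (glue-congˡ T≅S)
  ; deg≥2 = deg≥2′
  ; numDeg3-S = begin
      numDeg3 (glue S C x y)             ≡⟨ numDeg3-glue g degSx (Circle.deg2 circ y y∈H) ⟩
      suc (numDeg3 S) + suc (numDeg3 C)  ≡⟨ cong₂ (λ a b → suc a + suc b) numDeg3-S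
                                                   (numDeg3-circle circ) ⟩
      suc (2 * i + 1)                    ≡⟨ cong suc (+-comm (2 * i) 1) ⟩
      2 + 2 * i                          ≡⟨ sym (*-suc 2 i) ⟩
      2 * suc i                          ∎
  }
  where
    open ≡-Reasoning
    open Normalised N
    open GlueOK ok
    g : Gluable S C x y
    g = record
      { isGraphˡ = S-isGraph
      ; isGraphʳ = Circle.isGraph circ
      ; disjoint = λ v v∈S v∈C → disjoint v (from (proj₁ T≅S v) v∈S) v∈C
      ; x∈G = to (proj₁ T≅S x) x∈G
      ; y∈H = y∈H
      }
    degSx : deg S x ≡ 2
    degSx = ≤-antisym
      (≤-trans (deg-≤-≅ (IsGraph.V-unique S-isGraph) (≅-sym T≅S)) (≤-reflexive degx))
      (deg≥2 (Gluable.x∈G g))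
    deg≥2′ : ∀ {v} → v ∈ V (glue S C x y) → 2 ≤ deg (glue S C x y) v
    deg≥2′ m with ∈-++⁻ (V S) m
    ... | inj₁ v∈S = ≤-trans (deg≥2 v∈S) (deg-glue-≥ g v∈S)
    ... | inj₂ v∈C = ≤-trans (≤-reflexive (sym (Circle.deg2 circ _ v∈C))) (deg-glue-≥ʳ g v∈C)

normalised : ∀ {k C X} (D : Determines k C X) i → i < k → Normalised (Determines.T D i) i
normalised D zero 0<k = normalised-circle (Determines.circles D 0 0<k) (Determines.T0 D)
normalised D (suc i) i+1<k with Determines.Tstep D i i+1<k
... | _ , _ , ok , T≅glue =
  normalised-glue (normalised D i (<⇒≤ i+1<k)) (Determines.circles D (suc i) i+1<k) ok T≅glue

numDeg3-determined : ∀ {X k C} → IsGraph X → Determines k C X → numDeg3 X ≡ 2 * (k ∸ 1)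
numDeg3-determined {k = k} iX D =
  trans (numDeg3-≅ (IsGraph.V-unique iX) (IsGraph.V-unique S-isGraph) (≅-trans (≅-sym Tlast) T≅S))
        numDeg3-S
  where
    open Determines D
    open Normalised (normalised D (k ∸ 1) (∸-monoʳ-< z<s k≥1))

lemma4p7 : (X : Graph) → IsGraph X → (k : ℕ) → (C : ℕ → Graph) → Determines k C X →
           (numDeg3 X ≡ 2 * (k ∸ 1)) × ((k′ : ℕ) → (C′ : ℕ → Graph) → Determines k′ C′ X → k′ ≡ k)
lemma4p7 X iX k C D = numDeg3≡ , λ k′ C′ D′ →
  ∸-cancelʳ-≡ (Determines.k≥1 D′) (Determines.k≥1 D)
    (*-cancelˡ-≡ _ _ 2 (trans (sym (numDeg3-determined iX D′)) numDeg3≡))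
  where
    numDeg3≡ : numDeg3 X ≡ 2 * (k ∸ 1)
    numDeg3≡ = numDeg3-determined iX D
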